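{- Let $G$ be a finite graph and let $H$ be an isometric subgraph of $G$, i.e. a subgraph with $d_H(u,v)=d_G(u,v)$ for all $u,v\in V_H$. Then $\mathcal{L}(H)\le \mathcal{L}(G)$.
   Context: Lions and contamination game. Let $G=(V,E)$ be a finite graph. For $v\in V$, $N(v)$ is the set of neighbours of $v$. A lion strategy with $k\ge 1$ lions consists of initial positions $p_1(0),\dots,p_k(0)\in V$ and, for each time step $t\ge 1$, positions $p_i(t)\in\{p_i(t-1)\}\cup N(p_i(t-1))$ (each lion stays or moves along an edge). Put $L_t=\{p_1(t),\dots,p_k(t)\}$ and $\pi_t=\{(p_i(t-1),p_i(t)):1\le i\le k\}$. The contaminated sets are $W_0=V\setminus L_0$ and, for $t\ge 1$, $W_t=(W_{t-1}\setminus L_t)\cup\{v\in V\setminus L_t:\exists w\in W_{t-1}\cap N(v)\text{ with }(v,w)\notin\pi_t\text{ and }(w,v)\notin\pi_t\}$. The strategy clears $G$ if $W_T=\emptyset$ for some $T$. The lion number $\mathcal{L}(G)$ is the minimum $k$ such that some lion strategy with $k$ lions clears $G$. -}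

module Defs where

open import Data.Nat using (ℕ; zero; suc; _≤_)
open import Data.Fin using (Fin)
open import Data.Product using (Σ; _×_; ∃)
open import Data.Sum using (_⊎_)
open import Data.Empty using (⊥)
open import Relation.Nullary using (¬_)
open import Relation.Binary.PropositionalEquality using (_≡_)
open import Function using (_⇔_)
open import Function.Definitions using (Injective)

record Graph : Set₁ where
  field
    n     : ℕ
    Adj   : Fin n → Fin n → Set
    sym   : ∀ {u v} → Adj u v → Adj v u
    irrefl : ∀ {u} → ¬ Adj u u

open Graph public

V : Graph → Set
V G = Fin (n G)

data Walk (G : Graph) : V G → V G → ℕ → Set where
  here : ∀ {u} → Walk G u u 0
  step : ∀ {u w v l} → Adj G u w → Walk G w v l → Walk G u v (suc l)

-- d_G(u,v) = k  (if u,v are in different components no k satisfies this,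
-- i.e. the distance is ∞).
IsDist : (G : Graph) → V G → V G → ℕ → Set
IsDist G u v k = Walk G u v k × (∀ l → Walk G u v l → k ≤ l)

record Subgraph (H G : Graph) : Set where
  field
    ι       : V H → V G
    ι-inj   : Injective _≡_ _≡_ ι
    ι-edge  : ∀ {u v} → Adj H u v → Adj G (ι u) (ι v)

open Subgraph public

record IsometricSubgraph (H G : Graph) : Set where
  field
    sub      : Subgraph H G
    isometric : ∀ u v k → IsDist H u v k ⇔ IsDist G (ι sub u) (ι sub v) k

record LionStrategy (G : Graph) (k : ℕ) : Set where
  field
    pos  : ℕ → Fin k → V G
    move : ∀ t i → pos (suc t) i ≡ pos t i ⊎ Adj G (pos t i) (pos (suc t) i)

open LionStrategy public

module _ {G : Graph} {k : ℕ} (S : LionStrategy G k) where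
  InL : ℕ → V G → Set
  InL t v = Σ (Fin k) λ i → pos S t i ≡ v

  InΠ : ℕ → V G → V G → Set
  InΠ t x y = Σ (Fin k) λ i → pos S t i ≡ x × pos S (suc t) i ≡ y

  Contaminated : ℕ → V G → Set
  Contaminated zero v = ¬ InL zero v
  Contaminated (suc t) v =
    ¬ InL (suc t) v ×
    (Contaminated t v ⊎
     Σ (V G) λ w → Contaminated t w × Adj G v w
                   × ¬ InΠ t v w × ¬ InΠ t w v)

  Clears : Set
  Clears = Σ ℕ λ T → ∀ v → ¬ Contaminated T v

Clearable : Graph → ℕ → Set
Clearable G k = 1 ≤ k × Σ (LionStrategy G k) Clears

IsLionNumber : Graph → ℕ → Set
IsLionNumber G k = Clearable G k × (∀ j → Clearable G j → k ≤ j)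

module Submission where

-- Each lion of a strategy on G is replaced by a shadow lion on H that stands on the same
-- vertex whenever the original lion stands in H.  Between two visits to H the original lion
-- walks from one vertex of H to the other in the elapsed time, so by isometry a walk in H of
-- at most that length exists, and the shadow always heads towards the next vertex of H the
-- original lion will visit.  Every lion and every lion move inside H is then mirrored, so a
-- vertex contaminated in H is contaminated in G.  Choosing shortest walks needs decidable
-- adjacency in G; since a ≤ b is decidable, that may be assumed under a double negation.

open import Defs
open import Data.Nat using (ℕ; zero; suc; _+_; _≤_; _<_; _≤?_; z≤n; s≤s)
open import Data.Nat.Properties
  using (≤-refl; ≤-trans; ≤-pred; m≤n⇒m≤1+n; m≤n⇒m<n∨m≡n; ≰⇒>; +-mono-≤; m≤n⇒∃[o]m+o≡n; <⇒≤)
open import Data.Fin using (Fin)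
import Data.Fin.Properties as Fin
open import Data.Product using (Σ; _×_; _,_; proj₁; proj₂)
open import Data.Sum using (_⊎_; inj₁; inj₂)
open import Data.Empty using (⊥-elim)
open import Effect.Monad using (RawMonad)
open import Function using (_∘_; Equivalence)
open import Relation.Nullary using (¬_; Dec; yes; no)
open import Relation.Nullary.Decidable using (map′; _×-dec_; decidable-stable; ¬¬-excluded-middle)
open import Relation.Nullary.Negation using (¬¬-Monad)
open import Relation.Unary using (Decidable)
open import Relation.Binary.PropositionalEquality using (_≡_; refl; subst; subst₂)

private
  variable
    G H : Graph

¬¬-decidable-adjacency : (G : Graph) → ¬ ¬ (∀ u v → Dec (Adj G u v))
¬¬-decidable-adjacency G =
  Fin.sequence rawApplicative λ u → Fin.sequence rawApplicative λ v → ¬¬-excluded-middle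
  where open RawMonad ¬¬-Monad using (rawApplicative)

Minimal : (ℕ → Set) → ℕ → Set
Minimal P k = P k × (∀ j → P j → k ≤ j)

module _ {P : ℕ → Set} (P? : Decidable P) where

  minimal-upTo : ∀ n → (Σ ℕ λ k → k ≤ n × Minimal P k) ⊎ (∀ k → k ≤ n → ¬ P k)
  minimal-upTo zero with P? 0
  ... | yes p = inj₁ (0 , z≤n , p , λ _ _ → z≤n)
  ... | no ¬p = inj₂ λ { zero _ → ¬p }
  minimal-upTo (suc n) with minimal-upTo n
  ... | inj₁ (k , k≤n , min) = inj₁ (k , m≤n⇒m≤1+n k≤n , min)
  ... | inj₂ none with P? (suc n)
  ...   | yes p = inj₁ (suc n , ≤-refl , p , first)
    where
      first : ∀ j → P j → suc n ≤ j
      first j pj with j ≤? n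
      ... | yes j≤n = ⊥-elim (none j j≤n pj)
      ... | no j≰n  = ≰⇒> j≰n
  ...   | no ¬p = inj₂ none′
    where
      none′ : ∀ k → k ≤ suc n → ¬ P k
      none′ k k≤1+n with m≤n⇒m<n∨m≡n k≤1+n
      ... | inj₁ k<1+n = none k (≤-pred k<1+n)
      ... | inj₂ refl  = ¬p

  minimise : ∀ {n} → P n → Σ ℕ λ k → k ≤ n × Minimal P k
  minimise {n} p with minimal-upTo n
  ... | inj₁ found = found
  ... | inj₂ none  = ⊥-elim (none n ≤-refl p)

Walk≤ : (G : Graph) → V G → V G → ℕ → Set
Walk≤ G u v l = Σ ℕ λ k → k ≤ l × Walk G u v k

walk₀⇒≡ : ∀ {u v} → Walk G u v 0 → u ≡ v
walk₀⇒≡ here = refl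

_++ʷ_ : ∀ {u v w k l} → Walk G u v k → Walk G v w l → Walk G u w (k + l)
here     ++ʷ q = q
step a p ++ʷ q = step a (p ++ʷ q)

walk? : (∀ u v → Dec (Adj G u v)) → ∀ l u v → Dec (Walk G u v l)
walk? adj? zero u v = map′ (λ { refl → here }) walk₀⇒≡ (u Fin.≟ v)
walk? {G} adj? (suc l) u v =
  map′ (λ (w , a , p) → step a p) unstep
       (Fin.any? λ w → adj? u w ×-dec walk? adj? l w v)
  where
    unstep : Walk G u v (suc l) → Σ (V G) λ w → Adj G u w × Walk G w v l
    unstep (step a p) = _ , a , p

shortest-walk : (∀ u v → Dec (Adj G u v)) →
                ∀ {u v l} → Walk G u v l → Σ ℕ λ k → k ≤ l × IsDist G u v k
shortest-walk adj? = minimise (λ k → walk? adj? k _ _)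

isometric⇒walk≤ : (∀ u v → Dec (Adj G u v)) → (I : IsometricSubgraph H G) →
                  let open IsometricSubgraph I in
                  ∀ {x y l} → Walk G (ι sub x) (ι sub y) l → Walk≤ H x y l
isometric⇒walk≤ adj? I {x} {y} p with shortest-walk adj? p
... | k , k≤l , d = k , k≤l , proj₁ (Equivalence.from (isometric x y k) d)
  where open IsometricSubgraph I

Moves : (G : Graph) → (ℕ → V G) → Set
Moves G g = ∀ t → g (suc t) ≡ g t ⊎ Adj G (g t) (g (suc t))

moves⇒walk≤ : ∀ {g} → Moves G g → ∀ s d → Walk≤ G (g s) (g (s + d)) d
moves⇒walk≤ mv zero zero = 0 , z≤n , here
moves⇒walk≤ {G} {g} mv zero (suc d) with moves⇒walk≤ (mv ∘ suc) zero d | mv 0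
... | l , l≤d , p | inj₁ e = l , m≤n⇒m≤1+n l≤d , subst (λ u → Walk G u (g (suc d)) l) e p
... | l , l≤d , p | inj₂ a = suc l , s≤s l≤d , step a p
moves⇒walk≤ mv (suc s) d = moves⇒walk≤ (mv ∘ suc) s d

module Shadowing {G H : Graph} (ι : V H → V G)
                 (walk≤ : ∀ {x y l} → Walk G (ι x) (ι y) l → Walk≤ H x y l) where

  Shadows : ℕ → (ℕ → V G) → (ℕ → V H) → Set
  Shadows n g h = ∀ t → t ≤ n → ∀ y → g t ≡ ι y → h t ≡ y

  Hits : (ℕ → V G) → ℕ → Set
  Hits g t = Σ (V H) λ y → g t ≡ ι y

  hits? : ∀ g → Decidable (Hits g)
  hits? g t = Fin.any? λ y → g t Fin.≟ ι y

  CanMeet : (ℕ → V G) → ℕ → V H → Set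
  CanMeet g n x = ∀ τ → τ ≤ n → ∀ y → g τ ≡ ι y → Walk≤ H x y τ

  can-meet-now : ∀ {g n x y} → CanMeet g n x → g 0 ≡ ι y → x ≡ y
  can-meet-now meet e with meet 0 z≤n _ e
  ... | zero , _ , p = walk₀⇒≡ p

  can-meet-via-first-hit : ∀ {g} → Moves G g → ∀ {τ₁ y₁} → g τ₁ ≡ ι y₁ →
                       (∀ τ → Hits g τ → τ₁ ≤ τ) →
                       ∀ {x m} → m ≤ τ₁ → Walk H x y₁ m → ∀ n → CanMeet g n x
  can-meet-via-first-hit mv {τ₁} e₁ first {m = m} m≤τ₁ p n τ _ y e
    with m≤n⇒∃[o]m+o≡n (first τ (y , e))
  ... | d , refl with moves⇒walk≤ mv τ₁ d
  ... | l , l≤d , q with walk≤ (subst₂ (λ u w → Walk G u w l) e₁ e q)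
  ... | k , k≤l , r = m + k , +-mono-≤ m≤τ₁ (≤-trans k≤l l≤d) , p ++ʷ r

  can-meet-initially : ∀ {g} → Moves G g → V H → ∀ n → Σ (V H) (CanMeet g n)
  can-meet-initially {g} mv x₀ n with minimal-upTo (hits? g) n
  ... | inj₁ (τ₁ , _ , (y₁ , e₁) , first) = y₁ , can-meet-via-first-hit mv e₁ first z≤n here n
  ... | inj₂ none = x₀ , λ τ τ≤n y e → ⊥-elim (none τ τ≤n (y , e))

  -- The shadow takes the first step of a walk towards the next vertex of H that g visits.
  can-meet-step : ∀ {g} → Moves G g → ∀ {n x} → CanMeet g (suc n) x →
              Σ (V H) λ x′ → (x′ ≡ x ⊎ Adj H x x′) × CanMeet (g ∘ suc) n x′
  can-meet-step {g} mv {n} {x} meet with minimal-upTo (hits? (g ∘ suc)) n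
  ... | inj₂ none = x , inj₁ refl , λ τ τ≤n y e → ⊥-elim (none τ τ≤n (y , e))
  ... | inj₁ (τ₁ , τ₁≤n , (y₁ , e₁) , first) with meet (suc τ₁) (s≤s τ₁≤n) y₁ e₁
  ...   | zero , _ , p =
          x , inj₁ refl , can-meet-via-first-hit (mv ∘ suc) e₁ first z≤n p n
  ...   | suc m , s≤s m≤τ₁ , step a p =
          _ , inj₂ a , can-meet-via-first-hit (mv ∘ suc) e₁ first m≤τ₁ p n

  shadow : ∀ n {g} → Moves G g → ∀ {x} → CanMeet g n x →
           Σ (ℕ → V H) λ h → h 0 ≡ x × Moves H h × Shadows n g h
  shadow zero mv {x} meet =
    (λ _ → x) , refl , (λ _ → inj₁ refl) , λ { zero _ y e → can-meet-now meet e }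
  shadow (suc n) {g} mv {x} meet with can-meet-step mv meet
  ... | x′ , x→x′ , meet′ with shadow n (mv ∘ suc) meet′
  ... | h′ , refl , mv′ , sh′ = h , refl , mvh , shh
    where
      h : ℕ → V H
      h zero    = x
      h (suc t) = h′ t
      mvh : Moves H h
      mvh zero    = x→x′
      mvh (suc t) = mv′ t
      shh : Shadows (suc n) g h
      shh zero    _         y e = can-meet-now meet e
      shh (suc t) (s≤s t≤n)     = sh′ t t≤n

  shadow-strategy : ∀ {b} (S : LionStrategy G b) → V H → ∀ T →
                    Σ (LionStrategy H b) λ S′ →
                      ∀ i → Shadows T (λ t → pos S t i) (λ t → pos S′ t i)
  shadow-strategy {b} S x₀ T =
    record { pos = λ t i → proj₁ (lion i) t ; move = λ t i → proj₁ (proj₂ (lion i)) t } ,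
    λ i → proj₂ (proj₂ (lion i))
    where
      lion : ∀ (i : Fin b) → Σ (ℕ → V H) λ h → Moves H h × Shadows T (λ t → pos S t i) h
      lion i with can-meet-initially (λ t → move S t i) x₀ T
      ... | _ , meet with shadow T (λ t → move S t i) meet
      ...   | h , _ , mv , sh = h , mv , sh

module _ {G H : Graph} (ι : V H → V G) (ι-edge : ∀ {u v} → Adj H u v → Adj G (ι u) (ι v))
         {b} (S : LionStrategy G b) (S′ : LionStrategy H b) (T : ℕ)
         (shadows : ∀ i t → t ≤ T → ∀ y → pos S t i ≡ ι y → pos S′ t i ≡ y) where

  private
    lions-shadow : ∀ {t} → t ≤ T → ∀ {v} → InL S t (ι v) → InL S′ t v
    lions-shadow t≤T (i , e) = i , shadows i _ t≤T _ e

    steps-shadow : ∀ {t} → t < T → ∀ {v w} → InΠ S t (ι v) (ι w) → InΠ S′ t v w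
    steps-shadow t<T (i , e , e′) = i , shadows i _ (<⇒≤ t<T) _ e , shadows i _ t<T _ e′

  contaminated-shadow : ∀ t → t ≤ T → ∀ v → Contaminated S′ t v → Contaminated S t (ι v)
  contaminated-shadow zero t≤T v c = c ∘ lions-shadow t≤T
  contaminated-shadow (suc t) t<T v (free , inj₁ c) =
    free ∘ lions-shadow t<T , inj₁ (contaminated-shadow t (<⇒≤ t<T) v c)
  contaminated-shadow (suc t) t<T v (free , inj₂ (w , c , a , ¬vw , ¬wv)) =
    free ∘ lions-shadow t<T ,
    inj₂ (ι w , contaminated-shadow t (<⇒≤ t<T) w c , ι-edge a ,
          ¬vw ∘ steps-shadow t<T , ¬wv ∘ steps-shadow t<T)

  clears-shadow : (∀ v → ¬ Contaminated S T v) → ∀ v → ¬ Contaminated S′ T v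
  clears-shadow clear v = clear (ι v) ∘ contaminated-shadow T ≤-refl v

module _ (adj? : ∀ u v → Dec (Adj G u v)) (I : IsometricSubgraph H G) where
  open IsometricSubgraph I
  open Shadowing (ι sub) (isometric⇒walk≤ adj? I)

  isometric-clearable : V H → ∀ {b} → Clearable G b → Clearable H b
  isometric-clearable x₀ (1≤b , S , T , clear) with S′ , shadows ← shadow-strategy S x₀ T =
    1≤b , S′ , T , clears-shadow (ι sub) (ι-edge sub) S S′ T shadows clear

theorem8 : (G H : Graph) → IsometricSubgraph H G →
    ∀ a b → IsLionNumber H a → IsLionNumber G b → a ≤ b
theorem8 G H I zero b ((() , _) , _) _
theorem8 G H I (suc a) b ((_ , SH , _) , minimal) (clearable , _) =
  decidable-stable (suc a ≤? b) λ a≰b →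
    ¬¬-decidable-adjacency G λ adj? →
      a≰b (minimal b (isometric-clearable adj? I (pos SH 0 Fin.zero) clearable))
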